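{- There exists an epichristoffel word which cannot be written as the product of two epichristoffel words (for instance, over $\{a<b<c\}$, the epichristoffel word $aabacab$).
   Context: For letters $a,b$: $\psi_a(a)=\overline{\psi}_a(a)=a$, $\psi_a(x)=ax$, $\overline{\psi}_a(x)=xa$ for letters $x\neq a$, and $\theta_{ab}$ swaps $a,b$ and fixes other letters; episturmian morphisms are compositions of these. A word is $c$-epichristoffel if it is the image of a letter under an episturmian morphism; its conjugacy class (words $yx$ where $w=xy$) is an epichristoffel class. Given a total order on the alphabet, an epichristoffel word is the unique Lyndon word (lexicographically smallest conjugate, for a primitive word) in an epichristoffel class. -}

module Defs where

open import Data.Nat using (ℕ)
open import Data.Fin using (Fin; _≟_) renaming (_<_ to _<F_)
open import Data.List using (List; []; _∷_; _++_; concatMap)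
open import Data.List.Relation.Binary.Lex.Strict using (Lex-<)
open import Data.Product using (Σ; ∃; ∃-syntax; _×_; _,_)
open import Relation.Nullary using (¬_; yes; no)
open import Relation.Binary.PropositionalEquality using (_≡_)

Word : ℕ → Set
Word n = List (Fin n)

data Gen (n : ℕ) : Set where
  psi    : Fin n → Gen n
  psibar : Fin n → Gen n
  theta  : Fin n → Fin n → Gen n

genLetter : {n : ℕ} → Gen n → Fin n → Word n
genLetter (psi a) x with a ≟ x
... | yes _ = a ∷ []
... | no  _ = a ∷ x ∷ []
genLetter (psibar a) x with a ≟ x
... | yes _ = a ∷ []
... | no  _ = x ∷ a ∷ []
genLetter (theta a b) x with x ≟ a | x ≟ b
... | yes _ | _     = b ∷ []
... | no  _ | yes _ = a ∷ []
... | no  _ | no  _ = x ∷ []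

applyGen : {n : ℕ} → Gen n → Word n → Word n
applyGen g = concatMap (genLetter g)

applyEpi : {n : ℕ} → List (Gen n) → Word n → Word n
applyEpi []       w = w
applyEpi (g ∷ gs) w = applyGen g (applyEpi gs w)

CEpichristoffel : {n : ℕ} → Word n → Set
CEpichristoffel {n} w = Σ (List (Gen n)) λ f → Σ (Fin n) λ x → w ≡ applyEpi f (x ∷ [])

Conjugate : {n : ℕ} → Word n → Word n → Set
Conjugate {n} w u = Σ (Word n) λ x → Σ (Word n) λ y → (w ≡ x ++ y) × (u ≡ y ++ x)

_<lex_ : {n : ℕ} → Word n → Word n → Set
_<lex_ = Lex-< _≡_ _<F_

-- Lyndon word: nonempty and strictly smaller than each of its proper rotations
-- (equivalently: primitive and the lexicographically smallest conjugate).
Lyndon : {n : ℕ} → Word n → Set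
Lyndon {n} w = ¬ (w ≡ []) ×
  ((x y : Word n) → ¬ (x ≡ []) → ¬ (y ≡ []) → w ≡ x ++ y → w <lex (y ++ x))

-- Epichristoffel word: the Lyndon word of an epichristoffel class.
Epichristoffel : {n : ℕ} → Word n → Set
Epichristoffel {n} w = Lyndon w × Σ (Word n) λ v → CEpichristoffel v × Conjugate v w

-- The word aabacab = ψ_a ψ̄_b ψ_a (c) is a Lyndon word, hence epichristoffel.
-- In each factorization u v of it into nonempty words one factor has a
-- smaller rotation, except for u = aabac, which is not epichristoffel for an
-- abelian reason: the Parikh vector of a c-epichristoffel word arises from a
-- unit vector under the linear maps induced by the generators, and the set
-- formed by (1,1,1) and the permutations of (3,1,1) is closed under preimages
-- of these maps but contains no unit vector.  Conjugate words have the same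
-- Parikh vector, and aabac has Parikh vector (3,1,1).
module Submission where

open import Defs
open import Data.Nat using (ℕ; zero; suc; _+_) renaming (_≟_ to _≟ℕ_)
open import Data.Nat.Properties using (+-comm; +-assoc)
open import Data.Nat.Tactic.RingSolver using (solve-∀)
open import Data.Fin using (Fin; zero; suc; _≟_) renaming (_<?_ to _<F?_)
open import Data.Fin.Properties using (all?)
open import Data.Fin.Permutation.Components using (transpose)
open import Data.List using ([]; _∷_; _++_)
open import Data.List.Relation.Binary.Lex.Strict using (<-decidable)
open import Data.Product using (Σ; _×_; _,_)
open import Data.Product.Properties using (≡-dec)
open import Data.Empty using (⊥-elim)
open import Function using (_∘_)
open import Relation.Nullary using (¬_; Dec; yes; no)
open import Relation.Nullary.Decidable using (True; False; toWitness; toWitnessFalse)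
open import Relation.Binary.PropositionalEquality
  using (_≡_; refl; sym; trans; cong; cong₂; subst; module ≡-Reasoning)

a b c : Fin 3
a = zero
b = suc zero
c = suc (suc zero)

_<lex?_ : {n : ℕ} (u v : Word n) → Dec (u <lex v)
_<lex?_ = <-decidable _≟_ _<F?_

decide-<lex : {u v : Word 3} {_ : True (u <lex? v)} → u <lex v
decide-<lex {u} {v} {p} = toWitness {a? = u <lex? v} p

¬Lyndon-rotation : {n : ℕ} (x y : Word n) → ¬ x ≡ [] → ¬ y ≡ [] →
                   False ((x ++ y) <lex? (y ++ x)) → ¬ Lyndon (x ++ y)
¬Lyndon-rotation x y x≢[] y≢[] ≮ (_ , smallest) =
  toWitnessFalse ≮ (smallest x y x≢[] y≢[] refl)

aabacab aabac : Word 3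
aabacab = a ∷ a ∷ b ∷ a ∷ c ∷ a ∷ b ∷ []
aabac   = a ∷ a ∷ b ∷ a ∷ c ∷ []

aabacab-Lyndon : Lyndon aabacab
aabacab-Lyndon = (λ ()) , smaller-than-rotations
  where
  smaller-than-rotations : (x y : Word 3) → ¬ x ≡ [] → ¬ y ≡ [] →
                           aabacab ≡ x ++ y → aabacab <lex (y ++ x)
  smaller-than-rotations []                                _ x≢[] _    _    = ⊥-elim (x≢[] refl)
  smaller-than-rotations (_ ∷ [])                          _ _    _    refl = decide-<lex
  smaller-than-rotations (_ ∷ _ ∷ [])                      _ _    _    refl = decide-<lex
  smaller-than-rotations (_ ∷ _ ∷ _ ∷ [])                  _ _    _    refl = decide-<lex
  smaller-than-rotations (_ ∷ _ ∷ _ ∷ _ ∷ [])              _ _    _    refl = decide-<lex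
  smaller-than-rotations (_ ∷ _ ∷ _ ∷ _ ∷ _ ∷ [])          _ _    _    refl = decide-<lex
  smaller-than-rotations (_ ∷ _ ∷ _ ∷ _ ∷ _ ∷ _ ∷ [])      _ _    _    refl = decide-<lex
  smaller-than-rotations (_ ∷ _ ∷ _ ∷ _ ∷ _ ∷ _ ∷ _ ∷ [])  _ _    y≢[] refl = ⊥-elim (y≢[] refl)
  smaller-than-rotations (_ ∷ _ ∷ _ ∷ _ ∷ _ ∷ _ ∷ _ ∷ _ ∷ _) _ _   _    ()

aabacab-Epichristoffel : Epichristoffel aabacab
aabacab-Epichristoffel =
  aabacab-Lyndon , aabacab , (psi a ∷ psibar b ∷ psi a ∷ [] , c , refl) ,
  (aabacab , [] , refl , refl)

Parikh : Set
Parikh = ℕ × ℕ × ℕ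

_≟ₚ_ : (u v : Parikh) → Dec (u ≡ v)
_≟ₚ_ = ≡-dec _≟ℕ_ (≡-dec _≟ℕ_ _≟ℕ_)

𝟘 : Parikh
𝟘 = 0 , 0 , 0

_⊕_ : Parikh → Parikh → Parikh
(p , q , r) ⊕ (p′ , q′ , r′) = p + p′ , q + q′ , r + r′

⊕-assoc : ∀ u v w → (u ⊕ v) ⊕ w ≡ u ⊕ (v ⊕ w)
⊕-assoc (p , q , r) (p′ , q′ , r′) (p″ , q″ , r″) =
  cong₂ _,_ (+-assoc p p′ p″) (cong₂ _,_ (+-assoc q q′ q″) (+-assoc r r′ r″))

⊕-comm : ∀ u v → u ⊕ v ≡ v ⊕ u
⊕-comm (p , q , r) (p′ , q′ , r′) =
  cong₂ _,_ (+-comm p p′) (cong₂ _,_ (+-comm q q′) (+-comm r r′))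

_at_ : Parikh → Fin 3 → ℕ
(p , _ , _) at zero             = p
(_ , q , _) at suc zero         = q
(_ , _ , r) at suc (suc zero)   = r

at-⊕ : ∀ u v x → (u ⊕ v) at x ≡ u at x + v at x
at-⊕ _ _ zero             = refl
at-⊕ _ _ (suc zero)       = refl
at-⊕ _ _ (suc (suc zero)) = refl

tabulate : (Fin 3 → ℕ) → Parikh
tabulate f = f a , f b , f c

tabulate-cong : {f g : Fin 3 → ℕ} → (∀ x → f x ≡ g x) → tabulate f ≡ tabulate g
tabulate-cong f≗g = cong₂ _,_ (f≗g a) (cong₂ _,_ (f≗g b) (f≗g c))

unit : Fin 3 → Parikh
unit zero             = 1 , 0 , 0
unit (suc zero)       = 0 , 1 , 0
unit (suc (suc zero)) = 0 , 0 , 1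

parikh : Word 3 → Parikh
parikh []      = 𝟘
parikh (x ∷ w) = unit x ⊕ parikh w

parikh-++ : ∀ u v → parikh (u ++ v) ≡ parikh u ⊕ parikh v
parikh-++ []      v = refl
parikh-++ (x ∷ u) v =
  trans (cong (unit x ⊕_) (parikh-++ u v)) (sym (⊕-assoc (unit x) (parikh u) (parikh v)))

parikh-Conjugate : {v w : Word 3} → Conjugate v w → parikh v ≡ parikh w
parikh-Conjugate (x , y , refl , refl) = begin
  parikh (x ++ y)       ≡⟨ parikh-++ x y ⟩
  parikh x ⊕ parikh y   ≡⟨ ⊕-comm (parikh x) (parikh y) ⟩
  parikh y ⊕ parikh x   ≡⟨ sym (parikh-++ y x) ⟩
  parikh (y ++ x)       ∎
  where open ≡-Reasoning

-- ψ_x and ψ̄_x replace the number of x's by the length.  The sum is written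
-- starting with the other coordinates so that it reduces once they are known.
dilate : Fin 3 → Parikh → Parikh
dilate zero             (p , q , r) = q + (r + p) , q , r
dilate (suc zero)       (p , q , r) = p , r + (p + q) , r
dilate (suc (suc zero)) (p , q , r) = p , q , p + (q + r)

exchange : Fin 3 → Fin 3 → Parikh → Parikh
exchange x y v = tabulate λ z → v at transpose x y z

abel : Gen 3 → Parikh → Parikh
abel (psi x)     = dilate x
abel (psibar x)  = dilate x
abel (theta x y) = exchange x y

+-interchange₃ : ∀ k l m k′ l′ m′ →
                 (k + k′) + ((l + l′) + (m + m′)) ≡ (k + (l + m)) + (k′ + (l′ + m′))
+-interchange₃ = solve-∀

dilate-⊕ : ∀ x u v → dilate x (u ⊕ v) ≡ dilate x u ⊕ dilate x v
dilate-⊕ zero (p , q , r) (p′ , q′ , r′) =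
  cong (_, q + q′ , r + r′) (+-interchange₃ q r p q′ r′ p′)
dilate-⊕ (suc zero) (p , q , r) (p′ , q′ , r′) =
  cong (λ s → p + p′ , s , r + r′) (+-interchange₃ r p q r′ p′ q′)
dilate-⊕ (suc (suc zero)) (p , q , r) (p′ , q′ , r′) =
  cong (λ s → p + p′ , q + q′ , s) (+-interchange₃ p q r p′ q′ r′)

abel-⊕ : ∀ g u v → abel g (u ⊕ v) ≡ abel g u ⊕ abel g v
abel-⊕ (psi x)     = dilate-⊕ x
abel-⊕ (psibar x)  = dilate-⊕ x
abel-⊕ (theta x y) u v = tabulate-cong λ z → at-⊕ u v (transpose x y z)

all-Gen? : {P : Gen 3 → Set} → (∀ g → Dec (P g)) → Dec (∀ g → P g)
all-Gen? P? with all? (P? ∘ psi) | all? (P? ∘ psibar) | all? (λ x → all? λ y → P? (theta x y))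
... | yes ψ | yes ψ̄ | yes θ = yes λ { (psi x) → ψ x ; (psibar x) → ψ̄ x ; (theta x y) → θ x y }
... | no ¬ψ | _     | _     = no λ all → ¬ψ (all ∘ psi)
... | yes _ | no ¬ψ̄ | _     = no λ all → ¬ψ̄ (all ∘ psibar)
... | yes _ | yes _ | no ¬θ = no λ all → ¬θ λ x y → all (theta x y)

abel-𝟘 : ∀ g → abel g 𝟘 ≡ 𝟘
abel-𝟘 = toWitness {a? = all-Gen? λ g → abel g 𝟘 ≟ₚ 𝟘} _

parikh-genLetter : ∀ g x → parikh (genLetter g x) ≡ abel g (unit x)
parikh-genLetter =
  toWitness {a? = all-Gen? λ g → all? λ x → parikh (genLetter g x) ≟ₚ abel g (unit x)} _

parikh-applyGen : ∀ g w → parikh (applyGen g w) ≡ abel g (parikh w)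
parikh-applyGen g []      = sym (abel-𝟘 g)
parikh-applyGen g (x ∷ w) = begin
  parikh (genLetter g x ++ applyGen g w)          ≡⟨ parikh-++ (genLetter g x) (applyGen g w) ⟩
  parikh (genLetter g x) ⊕ parikh (applyGen g w)  ≡⟨ cong₂ _⊕_ (parikh-genLetter g x) (parikh-applyGen g w) ⟩
  abel g (unit x) ⊕ abel g (parikh w)             ≡⟨ sym (abel-⊕ g (unit x) (parikh w)) ⟩
  abel g (parikh (x ∷ w))                         ∎
  where open ≡-Reasoning

data Excluded : Parikh → Set where
  111ₑ : Excluded (1 , 1 , 1)
  311ₑ : Excluded (3 , 1 , 1)
  131ₑ : Excluded (1 , 3 , 1)
  113ₑ : Excluded (1 , 1 , 3)

Excluded-dilate⁻¹ : ∀ x v → Excluded (dilate x v) → Excluded v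
Excluded-dilate⁻¹ zero             (_ , 1 , 1) 311ₑ = 111ₑ
Excluded-dilate⁻¹ (suc zero)       (1 , _ , 1) 131ₑ = 111ₑ
Excluded-dilate⁻¹ (suc (suc zero)) (1 , 1 , _) 113ₑ = 111ₑ

Excluded-swap₀₁ : ∀ {p q r} → Excluded (q , p , r) → Excluded (p , q , r)
Excluded-swap₀₁ 111ₑ = 111ₑ
Excluded-swap₀₁ 311ₑ = 131ₑ
Excluded-swap₀₁ 131ₑ = 311ₑ
Excluded-swap₀₁ 113ₑ = 113ₑ

Excluded-swap₀₂ : ∀ {p q r} → Excluded (r , q , p) → Excluded (p , q , r)
Excluded-swap₀₂ 111ₑ = 111ₑ
Excluded-swap₀₂ 311ₑ = 113ₑ
Excluded-swap₀₂ 131ₑ = 131ₑ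
Excluded-swap₀₂ 113ₑ = 311ₑ

Excluded-swap₁₂ : ∀ {p q r} → Excluded (p , r , q) → Excluded (p , q , r)
Excluded-swap₁₂ 111ₑ = 111ₑ
Excluded-swap₁₂ 311ₑ = 311ₑ
Excluded-swap₁₂ 131ₑ = 113ₑ
Excluded-swap₁₂ 113ₑ = 131ₑ

Excluded-exchange⁻¹ : ∀ x y v → Excluded (exchange x y v) → Excluded v
Excluded-exchange⁻¹ zero             zero             _ e = e
Excluded-exchange⁻¹ (suc zero)       (suc zero)       _ e = e
Excluded-exchange⁻¹ (suc (suc zero)) (suc (suc zero)) _ e = e
Excluded-exchange⁻¹ zero             (suc zero)       _ e = Excluded-swap₀₁ e
Excluded-exchange⁻¹ (suc zero)       zero             _ e = Excluded-swap₀₁ e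
Excluded-exchange⁻¹ zero             (suc (suc zero)) _ e = Excluded-swap₀₂ e
Excluded-exchange⁻¹ (suc (suc zero)) zero             _ e = Excluded-swap₀₂ e
Excluded-exchange⁻¹ (suc zero)       (suc (suc zero)) _ e = Excluded-swap₁₂ e
Excluded-exchange⁻¹ (suc (suc zero)) (suc zero)       _ e = Excluded-swap₁₂ e

Excluded-abel⁻¹ : ∀ g v → Excluded (abel g v) → Excluded v
Excluded-abel⁻¹ (psi x)     = Excluded-dilate⁻¹ x
Excluded-abel⁻¹ (psibar x)  = Excluded-dilate⁻¹ x
Excluded-abel⁻¹ (theta x y) = Excluded-exchange⁻¹ x y

¬Excluded-applyEpi : ∀ f x → ¬ Excluded (parikh (applyEpi f (x ∷ [])))
¬Excluded-applyEpi [] zero             ()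
¬Excluded-applyEpi [] (suc zero)       ()
¬Excluded-applyEpi [] (suc (suc zero)) ()
¬Excluded-applyEpi (g ∷ f) x e =
  ¬Excluded-applyEpi f x (Excluded-abel⁻¹ g _ (subst Excluded (parikh-applyGen g w) e))
  where w = applyEpi f (x ∷ [])

aabac-¬Epichristoffel : ¬ Epichristoffel aabac
aabac-¬Epichristoffel (_ , v , (f , x , refl) , v~aabac) =
  ¬Excluded-applyEpi f x (subst Excluded (sym (parikh-Conjugate v~aabac)) 311ₑ)

aabacab-indecomposable : (u v : Word 3) → Epichristoffel u → Epichristoffel v → ¬ aabacab ≡ u ++ v
aabacab-indecomposable [] _ ((u≢[] , _) , _) _ _ = u≢[] refl
aabacab-indecomposable (_ ∷ []) _ _ (Lv , _) refl =
  ¬Lyndon-rotation (a ∷ b ∷ a ∷ c ∷ []) (a ∷ b ∷ []) (λ ()) (λ ()) _ Lv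
aabacab-indecomposable (_ ∷ _ ∷ []) _ (Lu , _) _ refl =
  ¬Lyndon-rotation (a ∷ []) (a ∷ []) (λ ()) (λ ()) _ Lu
aabacab-indecomposable (_ ∷ _ ∷ _ ∷ []) _ _ (Lv , _) refl =
  ¬Lyndon-rotation (a ∷ c ∷ []) (a ∷ b ∷ []) (λ ()) (λ ()) _ Lv
aabacab-indecomposable (_ ∷ _ ∷ _ ∷ _ ∷ []) _ _ (Lv , _) refl =
  ¬Lyndon-rotation (c ∷ []) (a ∷ b ∷ []) (λ ()) (λ ()) _ Lv
aabacab-indecomposable (_ ∷ _ ∷ _ ∷ _ ∷ _ ∷ []) _ Eu _ refl = aabac-¬Epichristoffel Eu
aabacab-indecomposable (_ ∷ _ ∷ _ ∷ _ ∷ _ ∷ _ ∷ []) _ (Lu , _) _ refl =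
  ¬Lyndon-rotation aabac (a ∷ []) (λ ()) (λ ()) _ Lu
aabacab-indecomposable (_ ∷ _ ∷ _ ∷ _ ∷ _ ∷ _ ∷ _ ∷ []) _ _ ((v≢[] , _) , _) refl = v≢[] refl
aabacab-indecomposable (_ ∷ _ ∷ _ ∷ _ ∷ _ ∷ _ ∷ _ ∷ _ ∷ _) _ _ _ ()

lemma4p15 : Σ (Word 3) λ w → Epichristoffel w ×
              ¬ (Σ (Word 3) λ u → Σ (Word 3) λ v →
                   Epichristoffel u × Epichristoffel v × (w ≡ u ++ v))
lemma4p15 = aabacab , aabacab-Epichristoffel ,
  λ (u , v , Eu , Ev , split) → aabacab-indecomposable u v Eu Ev split
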